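{- Let $\lambda=(m,n)$ be a triangular $2$-partition and $\mu=(m-i,n-j)$ a subpartition of $\lambda$. If $m-i>n-j$, then the $\nu$-Tamari rotation at the bottom line (line $1$) of $\mu$ is defined and equals $(m-i-1,n-j)$. If $n-j>0$, then the $\nu$-Tamari rotation at the upper line (line $2$) of $\mu$ is defined and equals $(m-i,n-j-1)$ if $i\le j$, and $(m-i-1,n-j-1)$ otherwise.
   Context: Partitions are drawn in French convention; line $k\ge1$ is the $k$-th row from the bottom, with $\lambda_k$ cells. A $2$-partition $(m,n)$ has $m\ge n\ge0$. A partition is triangular if there exist positive reals $r,s$ with $\lambda_j=\lfloor r-jr/s\rfloor$ for $1\le j\le s$ and $\lambda_j=0$ for $j>s$. $\nu$-Tamari rotation: for a subpartition $\mu\subseteq\lambda$ and a line $j$ with $\mu_j>\mu_{j+1}$, let $v=\lambda_j-\mu_j$ and let $i_0$ be the smallest integer with $0\le i_0<j$ such that $\lambda_k-\mu_k>v$ for all $i_0<k<j$; the rotation of $\mu$ at line $j$ is $\alpha$ with $\alpha_k=\mu_k-1$ for $i_0<k\le j$ and $\alpha_k=\mu_k$ otherwise.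
   Formalization: In the triangularity of λ, the positive numbers r and s range over the rationals instead of the reals. -}

module Defs where

open import Data.Nat using (ℕ; zero; suc; _≤_; _<_; _∸_)
open import Data.Integer using (ℤ; +_)
open import Data.Rational using (ℚ; Positive; _-_; _*_; _÷_; floor)
import Data.Rational as ℚ
open import Data.Rational.Properties using (pos⇒nonZero)
open import Data.Product using (Σ; _×_)
open import Relation.Binary.PropositionalEquality using (_≡_)
open import Relation.Nullary using (¬_)

-- A partition is a function ℕ → ℕ; line k (k ≥ 1, counted from the bottom)
-- has λ k cells.  Index 0 is irrelevant and ignored everywhere.
Partition : Set
Partition = ℕ → ℕ

pair : ℕ → ℕ → Partition
pair a b 0 = 0
pair a b 1 = a
pair a b 2 = b
pair a b (suc (suc (suc _))) = 0

ℕ→ℚ : ℕ → ℚ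
ℕ→ℚ k = (+ k) ℚ./ 1

jr/s : ℕ → (r s : ℚ) → .{{Positive s}} → ℚ
jr/s j r s = (ℕ→ℚ j * r ÷ s) {{pos⇒nonZero s}}

Triangular : Partition → Set
Triangular lam =
  Σ ℚ λ r → Σ ℚ λ s → Σ (Positive r) λ _ → Σ (Positive s) λ ps →
    ((j : ℕ) → 1 ≤ j →
        (ℕ→ℚ j ℚ.≤ s → + (lam j) ≡ floor (r - jr/s j r s {{ps}}))
      × (s ℚ.< ℕ→ℚ j → lam j ≡ 0))

GoodI0 : Partition → Partition → ℕ → ℕ → Set
GoodI0 lam mu j i0 =
  (k : ℕ) → i0 < k → k < j → (lam j ∸ mu j) < (lam k ∸ mu k)

IsRotation : Partition → Partition → ℕ → Partition → Set
IsRotation lam mu j alpha =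
  mu (suc j) < mu j ×
  Σ ℕ λ i0 → i0 < j × GoodI0 lam mu j i0 ×
    ((i' : ℕ) → i' < i0 → ¬ GoodI0 lam mu j i') ×
    ((k : ℕ) → 1 ≤ k →
        (i0 < k → k ≤ j → alpha k ≡ mu k ∸ 1)
      × (¬ (i0 < k × k ≤ j) → alpha k ≡ mu k))

{-# OPTIONS --safe #-}
module Submission where

open import Defs
open import Data.Nat using (ℕ; _≤_; _<_; _∸_; zero; suc; z≤n; s≤s; s≤s⁻¹)
open import Data.Nat.Properties using (m∸[m∸n]≡n; ≤⇒≯; <⇒≱)
open import Data.Product using (_×_; _,_)
open import Data.Empty using (⊥-elim)
open import Relation.Nullary using (¬_)
open import Relation.Binary.PropositionalEquality using (_≡_; refl; sym; subst₂)

-- For a 2-partition the rotation at line j can only choose i0 = j - 1 or i0 = 0,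
-- and at line 2 the choice is made by comparing the gaps λ_k - μ_k of the two
-- lines, which for μ = (m - i, n - j) are i and j.

goodI0-pred : ∀ lam mu j → GoodI0 lam mu (suc j) j
goodI0-pred lam mu j k j<k k<1+j = ⊥-elim (≤⇒≯ (s≤s⁻¹ k<1+j) j<k)

rotation-line1 : ∀ lam mu alpha → mu 2 < mu 1 →
  alpha 1 ≡ mu 1 ∸ 1 → (∀ k → 2 ≤ k → alpha k ≡ mu k) →
  IsRotation lam mu 1 alpha
rotation-line1 lam mu alpha drop α₁ α≥2 =
  drop , 0 , s≤s z≤n , goodI0-pred lam mu 0 , (λ _ ()) , shape
  where
  shape : ∀ k → 1 ≤ k → (0 < k → k ≤ 1 → alpha k ≡ mu k ∸ 1) × (¬ (0 < k × k ≤ 1) → alpha k ≡ mu k)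
  shape 1 _ = (λ _ _ → α₁) , (λ outside → ⊥-elim (outside (s≤s z≤n , s≤s z≤n)))
  shape (suc (suc k)) _ = (λ { _ (s≤s ()) }) , (λ _ → α≥2 (suc (suc k)) (s≤s (s≤s z≤n)))

rotation-line2-upper : ∀ lam mu alpha → mu 3 < mu 2 → lam 1 ∸ mu 1 ≤ lam 2 ∸ mu 2 →
  alpha 1 ≡ mu 1 → alpha 2 ≡ mu 2 ∸ 1 → (∀ k → 3 ≤ k → alpha k ≡ mu k) →
  IsRotation lam mu 2 alpha
rotation-line2-upper lam mu alpha drop gap α₁ α₂ α≥3 =
  drop , 1 , s≤s (s≤s z≤n) , goodI0-pred lam mu 1 , minimal , shape
  where
  minimal : ∀ i' → i' < 1 → ¬ GoodI0 lam mu 2 i'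
  minimal zero _ good = <⇒≱ (good 1 (s≤s z≤n) (s≤s (s≤s z≤n))) gap
  minimal (suc _) (s≤s ())
  shape : ∀ k → 1 ≤ k → (1 < k → k ≤ 2 → alpha k ≡ mu k ∸ 1) × (¬ (1 < k × k ≤ 2) → alpha k ≡ mu k)
  shape 1 _ = (λ { (s≤s ()) }) , (λ _ → α₁)
  shape 2 _ = (λ _ _ → α₂) , (λ outside → ⊥-elim (outside (s≤s (s≤s z≤n) , s≤s (s≤s z≤n))))
  shape (suc (suc (suc k))) _ = (λ { _ (s≤s (s≤s ())) }) , (λ _ → α≥3 (suc (suc (suc k))) (s≤s (s≤s (s≤s z≤n))))

rotation-line2-both : ∀ lam mu alpha → mu 3 < mu 2 → lam 2 ∸ mu 2 < lam 1 ∸ mu 1 →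
  alpha 1 ≡ mu 1 ∸ 1 → alpha 2 ≡ mu 2 ∸ 1 → (∀ k → 3 ≤ k → alpha k ≡ mu k) →
  IsRotation lam mu 2 alpha
rotation-line2-both lam mu alpha drop gap α₁ α₂ α≥3 =
  drop , 0 , s≤s z≤n , good , (λ _ ()) , shape
  where
  good : GoodI0 lam mu 2 0
  good 1 _ _ = gap
  good (suc (suc k)) _ (s≤s (s≤s ()))
  shape : ∀ k → 1 ≤ k → (0 < k → k ≤ 2 → alpha k ≡ mu k ∸ 1) × (¬ (0 < k × k ≤ 2) → alpha k ≡ mu k)
  shape 1 _ = (λ _ _ → α₁) , (λ outside → ⊥-elim (outside (s≤s z≤n , s≤s z≤n)))
  shape 2 _ = (λ _ _ → α₂) , (λ outside → ⊥-elim (outside (s≤s z≤n , s≤s (s≤s z≤n))))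
  shape (suc (suc (suc k))) _ = (λ { _ (s≤s (s≤s ())) }) , (λ _ → α≥3 (suc (suc (suc k))) (s≤s (s≤s (s≤s z≤n))))

pair-≥3 : ∀ a b c d k → 3 ≤ k → pair a b k ≡ pair c d k
pair-≥3 a b c d 1 (s≤s ())
pair-≥3 a b c d 2 (s≤s (s≤s ()))
pair-≥3 a b c d (suc (suc (suc k))) _ = refl

pair-≥2 : ∀ a b c k → 2 ≤ k → pair a b k ≡ pair c b k
pair-≥2 a b c 1 (s≤s ())
pair-≥2 a b c 2 _ = refl
pair-≥2 a b c (suc (suc (suc k))) _ = refl

proposition5p11 : (m n : ℕ) → n ≤ m → Triangular (pair m n) →
    (i j : ℕ) → i ≤ m → j ≤ n → n ∸ j ≤ m ∸ i →
      (n ∸ j < m ∸ i →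
          IsRotation (pair m n) (pair (m ∸ i) (n ∸ j)) 1 (pair (m ∸ i ∸ 1) (n ∸ j)))
    × (0 < n ∸ j →
          (i ≤ j → IsRotation (pair m n) (pair (m ∸ i) (n ∸ j)) 2 (pair (m ∸ i) (n ∸ j ∸ 1)))
        × (j < i → IsRotation (pair m n) (pair (m ∸ i) (n ∸ j)) 2 (pair (m ∸ i ∸ 1) (n ∸ j ∸ 1))))
proposition5p11 m n _ _ i j i≤m j≤n _ =
  (λ lt → rotation-line1 lam mu _ lt refl (pair-≥2 (m ∸ i ∸ 1) (n ∸ j) (m ∸ i))) ,
  λ pos →
    (λ i≤j → rotation-line2-upper lam mu _ pos (subst₂ _≤_ (sym gap₁) (sym gap₂) i≤j)
               refl refl (pair-≥3 _ _ _ _)) ,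
    (λ j<i → rotation-line2-both lam mu _ pos (subst₂ _<_ (sym gap₂) (sym gap₁) j<i)
               refl refl (pair-≥3 _ _ _ _))
  where
  lam mu : Partition
  lam = pair m n
  mu = pair (m ∸ i) (n ∸ j)
  gap₁ : m ∸ (m ∸ i) ≡ i
  gap₁ = m∸[m∸n]≡n i≤m
  gap₂ : n ∸ (n ∸ j) ≡ j
  gap₂ = m∸[m∸n]≡n j≤n
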